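{- Let $b$ be a Type-$1$ node of the cactus $\mathfrak{C}_G$ and let $w\in V$ be the vertex with $\phi(w)=b$. Let $\delta(Z_1),\ldots,\delta(Z_d)$ be all basic $K$-cuts associated with $b$. Then $\widetilde{T} \cap \bigcup_{i=1}^d \delta(Z_i) \subseteq E_w$.
   Context: $G=(V,E)$ is a $K$-edge-connected graph, and $\widetilde{T}$ is a spanning tree of $G$ with congestion at most $K$ (the congestion of a tree edge $e$ is the number of edges of $G$ crossing the cut induced by $e$, i.e. between the two components of $\widetilde{T}-e$). For $X\subseteq V$, $\delta(X)$ denotes the set of edges between $X$ and $V\setminus X$; it is a $K$-cut if $|\delta(X)|=K$. $E_w$ denotes the set of edges of $G$ incident with $w$. $(\mathfrak{C}_G,\phi)$ is a cactus representation of $G$: $\mathfrak{C}_G=(U,F)$ is a cactus graph (a connected multigraph, with nodes and links, in which every link belongs to exactly one cycle) and $\phi:V\to U$ is a map such that $\delta(X)$ is a $K$-cut of $G$ if and only if $X=\phi^{ -1}(Q)$ for some $Q\subseteq U$ with $\delta(Q)$ a $2$-cut of $\mathfrak{C}_G$. Under the assumption on $\widetilde{T}$, every node $b$ satisfies $|\phi^{ -1}(b)|\le 1$; $b$ is called Type-$1$ if $|\phi^{ -1}(b)|=1$. A basic $K$-cut associated with node $b$ is a $K$-cut represented by a pair of links of $\mathfrak{C}_G$ that share the node $b$ (and lie on the same cycle); if $b$ has degree $2d$, its incident links form $d$ such pairs, and the corresponding basic cuts are written $\delta(Z_1),\ldots,\delta(Z_d)$ with $Z_i=\phi^{ -1}(Q_i)$,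 where $Q_i$ is the shore of the corresponding $2$-cut of $\mathfrak{C}_G$ not containing $b$. The sets $Z_1,\ldots,Z_d$ partition $V\setminus\phi^{ -1}(b)$. -}

module Defs where

open import Data.Nat using (ℕ; zero; suc; _≤_)
open import Data.Fin using (Fin; zero; suc; inject₁; fromℕ)
open import Data.Bool using (Bool; true; false; if_then_else_; _xor_)
open import Data.List using (List; map; allFin)
open import Data.Nat.ListAction using (sum)
open import Data.Unit using (⊤)
open import Data.Product using (Σ; ∃; _×_; _,_)
open import Data.Sum using (_⊎_)
open import Relation.Binary.PropositionalEquality using (_≡_; _≢_)
open import Relation.Nullary using (¬_)
open import Function.Bundles using (_⇔_)

record MultiGraph : Set where
  field
    nV  : ℕ
    nE  : ℕ
    src : Fin nE → Fin nV
    tgt : Fin nE → Fin nV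

module _ (G : MultiGraph) where
  open MultiGraph G

  Vertex : Set
  Vertex = Fin nV

  Edge : Set
  Edge = Fin nE

  VSet : Set
  VSet = Vertex → Bool

  ESet : Set
  ESet = Edge → Bool

  Joins : Edge → Vertex → Vertex → Set
  Joins e u v = (src e ≡ u × tgt e ≡ v) ⊎ (src e ≡ v × tgt e ≡ u)

  IncidentWith : Vertex → Edge → Set
  IncidentWith w e = src e ≡ w ⊎ tgt e ≡ w

  crosses : VSet → Edge → Bool
  crosses X e = X (src e) xor X (tgt e)

  cutSize : VSet → ℕ
  cutSize X = sum (map (λ e → if crosses X e then 1 else 0) (allFin nE))

  data Reach (S : Edge → Set) : Vertex → Vertex → Set where
    here : ∀ {u} → Reach S u u
    step : ∀ {u v x} (e : Edge) → S e → Joins e u v → Reach S v x → Reach S u x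

  Connected : Set
  Connected = ∀ u v → Reach (λ _ → ⊤) u v

  EdgeConnected : ℕ → Set
  EdgeConnected K = ∀ (X : VSet) → (∃ λ u → X u ≡ true) → (∃ λ v → X v ≡ false)
                    → K ≤ cutSize X

  InT : ESet → Edge → Set
  InT T e = T e ≡ true

  InT-minus : ESet → Edge → Edge → Set
  InT-minus T e f = (T f ≡ true) × (f ≢ e)

  IsSpanningTree : ESet → Set
  IsSpanningTree T = (∀ u v → Reach (InT T) u v)
                   × (∀ e → T e ≡ true → ¬ Reach (InT-minus T e) (src e) (tgt e))

  IsComponentOf : ESet → Edge → VSet → Set
  IsComponentOf T e X = ∀ v → (X v ≡ true) ⇔ Reach (InT-minus T e) (src e) v

  -- congestion of every tree edge is at most K (the cut between the two
  -- components of T - e is δ(component containing src e))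
  CongestionAtMost : ESet → ℕ → Set
  CongestionAtMost T K = ∀ e → T e ≡ true → ∀ X → IsComponentOf T e X → cutSize X ≤ K

  -- A cycle: links l₀..l_len (distinct), nodes v₀..v_len (distinct), v_{len+1} = v₀,
  -- link lᵢ joins vᵢ and vᵢ₊₁.
  record Cycle : Set where
    field
      len      : ℕ
      link     : Fin (suc len) → Edge
      node     : Fin (suc (suc len)) → Vertex
      closed   : node (fromℕ (suc len)) ≡ node zero
      link-inj : ∀ i j → link i ≡ link j → i ≡ j
      node-inj : ∀ i j → node (inject₁ i) ≡ node (inject₁ j) → i ≡ j
      joins    : ∀ i → Joins (link i) (node (inject₁ i)) (node (suc i))

  OnCycle : Edge → Cycle → Set
  OnCycle f c = ∃ λ i → Cycle.link c i ≡ f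

  IsCactus : Set
  IsCactus = Connected
           × (∀ f → (∃ λ c → OnCycle f c)
                  × (∀ c₁ c₂ → OnCycle f c₁ → OnCycle f c₂ → ∀ g → OnCycle g c₁ ⇔ OnCycle g c₂))

preimage : (G C : MultiGraph) → (Vertex G → Vertex C) → VSet C → VSet G
preimage G C φ Q v = Q (φ v)

IsCactusRep : (G : MultiGraph) → ℕ → (C : MultiGraph) → (Vertex G → Vertex C) → Set
IsCactusRep G K C φ =
  IsCactus C ×
  (∀ (X : VSet G) → (cutSize G X ≡ K) ⇔
      (∃ λ (Q : VSet C) → (cutSize C Q ≡ 2) × (∀ v → X v ≡ Q (φ v))))

-- Q is the shore not containing b of the 2-cut of C formed by two distinct links
-- f, g of one cycle that share node b; φ⁻¹(Q) is then a basic K-cut associated with b.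
IsBasicShore : (C : MultiGraph) → Vertex C → VSet C → Set
IsBasicShore C b Q =
  Σ (Cycle C) λ c → Σ (Edge C) λ f → Σ (Edge C) λ g →
    OnCycle C f c × OnCycle C g c × f ≢ g ×
    IncidentWith C b f × IncidentWith C b g ×
    (∀ h → (crosses C Q h ≡ true) ⇔ (h ≡ f ⊎ h ≡ g)) ×
    Q b ≡ false

{-# OPTIONS --safe #-}
-- If a tree edge e crossed the basic cut δ(φ⁻¹ Q) without touching w, let e₁ be the last
-- edge of the tree path from e to w; e₁ ends at w. The component of T − e₁ avoiding w
-- contains both ends of e, and its cut has at most K edges (congestion) and at least K
-- (edge-connectivity), so it is a K-cut φ⁻¹ P with δ(P) a 2-cut of the cactus; the shore Y
-- of P not containing b contains φ of both ends of e, hence meets both Q and its complement.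
-- Every link of δ(Q) touches b ∉ Y, so no link inside Y crosses Q, and Y ∩ Q, Y ∖ Q leave Y
-- through disjoint sets of links of δ(Y). Since every link lies on a cycle, Y ∩ Q leaves
-- through at least two of them and Y ∖ Q through one more: too many for a 2-cut.
module Submission where

open import Defs
open import Data.Nat using (ℕ; zero; suc; _≤_; s≤s; z≤n)
open import Data.Nat.Properties using (≤-trans; m≤n+m; ≤-antisym; n≮n)
open import Data.Fin using (Fin; zero; suc; inject₁; fromℕ)
open import Data.Fin.Properties using (suc-injective) renaming (_≟_ to _≟ᶠ_)
open import Data.Bool using (Bool; true; false; _xor_; _∧_; not; if_then_else_)
open import Data.Bool.Properties
  using (xor-comm; xor-same; xor-inverseˡ; xor-inverseʳ; ⇔→≡) renaming (_≟_ to _≟ᵇ_)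
open import Data.List using (List; _∷_; map; allFin)
open import Data.List.Properties using (map-cong)
open import Data.Nat.ListAction using (sum)
open import Data.List.Membership.Propositional using (_∈_)
open import Data.List.Membership.Propositional.Properties using (∈-allFin)
open import Data.List.Relation.Unary.Any using (here; there)
open import Data.Empty using (⊥; ⊥-elim)
open import Data.Product using (∃; ∃₂; _×_; _,_; proj₁; proj₂)
open import Data.Sum using (_⊎_; inj₁; inj₂; [_,_]) renaming (map to ⊎-map)
open import Function using (_∘_)
open import Function.Bundles using (mk⇔; Equivalence)
open Equivalence using (to; from)
open import Relation.Binary.PropositionalEquality
  using (_≡_; _≢_; refl; sym; trans; cong; cong₂; subst; subst₂)
open import Relation.Nullary using (¬_; Dec; yes; no; does)
open import Relation.Nullary.Decidable using (decidable-stable; _⊎-dec_)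

xor≡true⇒≢ : ∀ x y → x xor y ≡ true → x ≢ y
xor≡true⇒≢ false false ()
xor≡true⇒≢ false true  _ ()
xor≡true⇒≢ true  false _ ()
xor≡true⇒≢ true  true  ()

≢⇒xor≡true : ∀ x y → x ≢ y → x xor y ≡ true
≢⇒xor≡true false false x≢y = ⊥-elim (x≢y refl)
≢⇒xor≡true false true  _   = refl
≢⇒xor≡true true  false _   = refl
≢⇒xor≡true true  true  x≢y = ⊥-elim (x≢y refl)

xor-cancelʳ : ∀ x y c → (x xor c) xor (y xor c) ≡ x xor y
xor-cancelʳ false false c = xor-same c
xor-cancelʳ false true  c = xor-inverseʳ c
xor-cancelʳ true  false c = xor-inverseˡ c
xor-cancelʳ true  true  c = xor-same (not c)

∧-xor⇒xor : ∀ y y′ q q′ → (y ≡ true → y′ ≡ true → q ≡ q′) →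
            (y ∧ q) xor (y′ ∧ q′) ≡ true → y xor y′ ≡ true
∧-xor⇒xor true  true  q q′ agree x = ⊥-elim (xor≡true⇒≢ q q′ x (agree refl refl))
∧-xor⇒xor true  false _ _ _ _ = refl
∧-xor⇒xor false true  _ _ _ _ = refl
∧-xor⇒xor false false _ _ _ ()

∧-xor-∧-not-xor : ∀ y y′ q q′ → (y ≡ true → y′ ≡ true → q ≡ q′) →
                  (y ∧ q) xor (y′ ∧ q′) ≡ true → (y ∧ not q) xor (y′ ∧ not q′) ≡ true → ⊥
∧-xor-∧-not-xor true  true  q     q′    agree x _ = xor≡true⇒≢ q q′ x (agree refl refl)
∧-xor-∧-not-xor true  false true  q′    _ _ ()
∧-xor-∧-not-xor true  false false q′    _ () _
∧-xor-∧-not-xor false true  q     true  _ _ ()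
∧-xor-∧-not-xor false true  q     false _ () _
∧-xor-∧-not-xor false false q     q′    _ () _

module Counting {A : Set} (p : A → Bool) where

  count : List A → ℕ
  count xs = sum (map (λ x → if p x then 1 else 0) xs)

  count-∷ : ∀ x xs → count xs ≤ count (x ∷ xs)
  count-∷ x xs = m≤n+m (count xs) (if p x then 1 else 0)

  ∈-tail : ∀ {x y : A} {xs} → y ∈ x ∷ xs → y ≢ x → y ∈ xs
  ∈-tail (here y≡x) y≢x = ⊥-elim (y≢x y≡x)
  ∈-tail (there y∈xs) _ = y∈xs

  1≤count : ∀ {x xs} → x ∈ xs → p x ≡ true → 1 ≤ count xs
  1≤count (here refl) px rewrite px = s≤s z≤n
  1≤count {xs = z ∷ xs} (there x∈) px = ≤-trans (1≤count x∈ px) (count-∷ z xs)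

  2≤count : ∀ {x y xs} → x ∈ xs → y ∈ xs → x ≢ y → p x ≡ true → p y ≡ true → 2 ≤ count xs
  2≤count (here refl) y∈ x≢y px py rewrite px = s≤s (1≤count (∈-tail y∈ (x≢y ∘ sym)) py)
  2≤count (there x∈) (here refl) x≢y px py rewrite py = s≤s (1≤count x∈ px)
  2≤count {xs = z ∷ xs} (there x∈) (there y∈) x≢y px py =
    ≤-trans (2≤count x∈ y∈ x≢y px py) (count-∷ z xs)

  3≤count : ∀ {x y z xs} → x ∈ xs → y ∈ xs → z ∈ xs → x ≢ y → x ≢ z → y ≢ z →
            p x ≡ true → p y ≡ true → p z ≡ true → 3 ≤ count xs
  3≤count (here refl) y∈ z∈ x≢y x≢z y≢z px py pz rewrite px =
    s≤s (2≤count (∈-tail y∈ (x≢y ∘ sym)) (∈-tail z∈ (x≢z ∘ sym)) y≢z py pz)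
  3≤count (there x∈) (here refl) z∈ x≢y x≢z y≢z px py pz rewrite py =
    s≤s (2≤count x∈ (∈-tail z∈ (y≢z ∘ sym)) x≢z px pz)
  3≤count (there x∈) (there y∈) (here refl) x≢y x≢z y≢z px py pz rewrite pz =
    s≤s (2≤count x∈ y∈ x≢y px py)
  3≤count {xs = w ∷ xs} (there x∈) (there y∈) (there z∈) x≢y x≢z y≢z px py pz =
    ≤-trans (3≤count x∈ y∈ z∈ x≢y x≢z y≢z px py pz) (count-∷ w xs)

some-step-changes : ∀ m (f : Fin (suc m) → Bool) → f zero ≢ f (fromℕ m) →
                    ∃ λ (j : Fin m) → f (inject₁ j) ≢ f (suc j)
some-step-changes zero    f f₀≢fₘ = ⊥-elim (f₀≢fₘ refl)
some-step-changes (suc m) f f₀≢fₘ with f zero ≟ᵇ f (suc zero)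
... | no  f₀≢f₁ = zero , f₀≢f₁
... | yes f₀≡f₁ with some-step-changes m (f ∘ suc) (f₀≢fₘ ∘ trans f₀≡f₁)
...   | j , fⱼ≢fⱼ₊₁ = suc j , fⱼ≢fⱼ₊₁

another-step-changes : ∀ m (f : Fin (suc m) → Bool) → f (fromℕ m) ≡ f zero →
                       (i : Fin m) → f (inject₁ i) ≢ f (suc i) →
                       ∃ λ (j : Fin m) → j ≢ i × f (inject₁ j) ≢ f (suc j)
another-step-changes (suc m) f closed zero f₀≢f₁
  with some-step-changes m (f ∘ suc) (λ f₁≡fₘ → f₀≢f₁ (sym (trans f₁≡fₘ closed)))
... | j , fⱼ≢fⱼ₊₁ = suc j , (λ ()) , fⱼ≢fⱼ₊₁
another-step-changes (suc m) f closed (suc i) fᵢ≢fᵢ₊₁ with f zero ≟ᵇ f (suc zero)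
... | no  f₀≢f₁ = zero , (λ ()) , f₀≢f₁
... | yes f₀≡f₁ with another-step-changes m (f ∘ suc) (trans closed f₀≡f₁) i fᵢ≢fᵢ₊₁
...   | j , j≢i , fⱼ≢fⱼ₊₁ = suc j , j≢i ∘ suc-injective , fⱼ≢fⱼ₊₁

module MultiGraphProperties (G : MultiGraph) where
  open MultiGraph G

  incident? : ∀ w h → Dec (IncidentWith G w h)
  incident? w h = (src h ≟ᶠ w) ⊎-dec (tgt h ≟ᶠ w)

  joins-sym : ∀ {h a c} → Joins G h a c → Joins G h c a
  joins-sym (inj₁ ends) = inj₂ ends
  joins-sym (inj₂ ends) = inj₁ ends

  joins-incident : ∀ {h a c} → Joins G h a c → IncidentWith G c h
  joins-incident (inj₁ (_ , t≡c)) = inj₂ t≡c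
  joins-incident (inj₂ (s≡c , _)) = inj₁ s≡c

  joins-avoids : ∀ {h a c w} → Joins G h a c → a ≢ w → c ≢ w → ¬ IncidentWith G w h
  joins-avoids (inj₁ (refl , refl)) a≢w c≢w = [ a≢w , c≢w ]
  joins-avoids (inj₂ (refl , refl)) a≢w c≢w = [ c≢w , a≢w ]

  crosses-joins : ∀ (Y : VSet G) {h a c} → Joins G h a c → crosses G Y h ≡ Y a xor Y c
  crosses-joins Y (inj₁ (refl , refl)) = refl
  crosses-joins Y {a = a} {c} (inj₂ (refl , refl)) = xor-comm (Y c) (Y a)

  crossing-ends-differ : ∀ (Y : VSet G) {h a c} → Joins G h a c →
                         crosses G Y h ≡ true → Y a ≢ Y c
  crossing-ends-differ Y h-joins Yh = xor≡true⇒≢ _ _ (trans (sym (crosses-joins Y h-joins)) Yh)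

  differing-ends-cross : ∀ (Y : VSet G) {h a c} → Joins G h a c →
                         Y a ≢ Y c → crosses G Y h ≡ true
  differing-ends-cross Y h-joins Ya≢Yc = trans (crosses-joins Y h-joins) (≢⇒xor≡true _ _ Ya≢Yc)

  cutSize-xor : ∀ (Y : VSet G) c → cutSize G (λ v → Y v xor c) ≡ cutSize G Y
  cutSize-xor Y c = cong sum (map-cong indicator-eq (allFin nE))
    where
    indicator-eq : ∀ h → (if crosses G (λ v → Y v xor c) h then 1 else 0)
                       ≡ (if crosses G Y h then 1 else 0)
    indicator-eq h = cong (λ b → if b then 1 else 0) (xor-cancelʳ (Y (src h)) (Y (tgt h)) c)

  3≤cutSize : ∀ (Y : VSet G) {h₁ h₂ h₃} → h₁ ≢ h₂ → h₁ ≢ h₃ → h₂ ≢ h₃ →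
              crosses G Y h₁ ≡ true → crosses G Y h₂ ≡ true → crosses G Y h₃ ≡ true →
              3 ≤ cutSize G Y
  3≤cutSize Y = Counting.3≤count (crosses G Y) (∈-allFin _) (∈-allFin _) (∈-allFin _)

  reach-map : ∀ {S S′ : Edge G → Set} → (∀ {h} → S h → S′ h) →
              ∀ {a c} → Reach G S a c → Reach G S′ a c
  reach-map f here                     = here
  reach-map f (step h Sh h-joins path) = step h (f Sh) h-joins (reach-map f path)

  reach-trans : ∀ {S a c d} → Reach G S a c → Reach G S c d → Reach G S a d
  reach-trans here                     path′ = path′
  reach-trans (step h Sh h-joins path) path′ = step h Sh h-joins (reach-trans path path′)

  reach-sym : ∀ {S a c} → Reach G S a c → Reach G S c a
  reach-sym here                     = here
  reach-sym (step h Sh h-joins path) =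
    reach-trans (reach-sym path) (step h Sh (joins-sym h-joins) here)

  walk-crosses : ∀ {S} (Y : VSet G) {a c} → Reach G S a c → Y a ≡ true → Y c ≡ false →
                 ∃ λ h → S h × crosses G Y h ≡ true
  walk-crosses Y here Ya Yc with trans (sym Ya) Yc
  ... | ()
  walk-crosses Y (step {v = v} h Sh h-joins path) Ya Yc with Y v in Yv
  ... | true  = walk-crosses Y path Yv Yc
  ... | false = h , Sh , trans (crosses-joins Y h-joins) (cong₂ _xor_ Ya Yv)

  first-entry : ∀ {S} w {a} → Reach G S a w → a ≢ w →
                ∃₂ λ e u → S e × Joins G e u w × Reach G (λ h → S h × ¬ IncidentWith G w h) a u
  first-entry w here a≢w = ⊥-elim (a≢w refl)
  first-entry w {a} (step {v = v} h Sh h-joins path) a≢w with v ≟ᶠ w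
  ... | yes refl = h , a , Sh , h-joins , here
  ... | no  v≢w with first-entry w path v≢w
  ...   | e , u , Se , e-joins , path′ =
          e , u , Se , e-joins , step h (Sh , joins-avoids h-joins a≢w v≢w) h-joins path′

module SpanningTree (G : MultiGraph) (T : ESet G) (tree : IsSpanningTree G T) where
  open MultiGraph G
  open MultiGraphProperties G

  ends-reach : ∀ e v → Reach G (InT-minus G T e) (src e) v ⊎ Reach G (InT-minus G T e) (tgt e) v
  ends-reach e v = go (proj₁ tree (src e) v) (inj₁ here)
    where
    R : Vertex G → Vertex G → Set
    R = Reach G (InT-minus G T e)

    other-end : ∀ {a c} → Joins G e a c → R (src e) c ⊎ R (tgt e) c
    other-end (inj₁ (_ , refl)) = inj₂ here
    other-end (inj₂ (refl , _)) = inj₁ here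

    go : ∀ {a c} → Reach G (InT G T) a c → R (src e) a ⊎ R (tgt e) a → R (src e) c ⊎ R (tgt e) c
    go here reached = reached
    go (step h Th h-joins path) reached with h ≟ᶠ e
    ... | yes refl = go path (other-end h-joins)
    ... | no  h≢e  = go path (⊎-map extend extend reached)
      where
      extend : ∀ {x} → R x _ → R x _
      extend r = reach-trans r (step h (Th , h≢e) h-joins here)

  component-exists : ∀ e → T e ≡ true → ∃ (IsComponentOf G T e)
  component-exists e Te = (λ v → does (reach? v)) , is-component
    where
    reach? : ∀ v → Dec (Reach G (InT-minus G T e) (src e) v)
    reach? v with ends-reach e v
    ... | inj₁ r = yes r
    ... | inj₂ r = no λ r′ → proj₂ tree e Te (reach-trans r′ (reach-sym r))

    is-component : IsComponentOf G T e (λ v → does (reach? v))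
    is-component v with reach? v
    ... | yes r  = mk⇔ (λ _ → r) (λ _ → refl)
    ... | no  ¬r = mk⇔ (λ ()) (⊥-elim ∘ ¬r)

  module _ {e : Edge G} {X : VSet G} (component : IsComponentOf G T e X) where

    component-src : X (src e) ≡ true
    component-src = from (component (src e)) here

    component-tgt : T e ≡ true → X (tgt e) ≡ false
    component-tgt Te with X (tgt e) in Xt
    ... | true  = ⊥-elim (proj₂ tree e Te (to (component (tgt e)) Xt))
    ... | false = refl

    component-crossed : T e ≡ true → crosses G X e ≡ true
    component-crossed Te = cong₂ _xor_ component-src (component-tgt Te)

    component-walk : ∀ {a c} → Reach G (InT-minus G T e) a c → X a ≡ X c
    component-walk {a} {c} path = ⇔→≡ {z = true} (mk⇔
      (λ Xa → from (component c) (reach-trans (to (component a) Xa) path))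
      (λ Xc → from (component a) (reach-trans (to (component c) Xc) (reach-sym path))))

    component-cutSize : ∀ {K} → EdgeConnected G K → CongestionAtMost G T K →
                        T e ≡ true → cutSize G X ≡ K
    component-cutSize connected congestion Te = ≤-antisym
      (congestion e Te X component)
      (connected X (src e , component-src) (tgt e , component-tgt Te))

  K-cut-separating : ∀ {K} → EdgeConnected G K → CongestionAtMost G T K →
                     ∀ w e → T e ≡ true → ¬ IncidentWith G w e →
                     ∃ λ X → cutSize G X ≡ K × X (src e) ≡ X (tgt e) × X (src e) ≢ X w
  K-cut-separating connected congestion w e Te ¬w∈e
    with first-entry w (proj₁ tree (src e) w) (¬w∈e ∘ inj₁)
  ... | e₁ , u , Te₁ , u-w , path with component-exists e₁ Te₁
  ...   | X , component =
          X , component-cutSize component connected congestion Te₁ , X-src≡X-tgt , X-src≢X-w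
    where
    avoids-e₁ : ∀ {h} → ¬ IncidentWith G w h → h ≢ e₁
    avoids-e₁ ¬w∈h refl = ¬w∈h (joins-incident u-w)

    X-src≡X-tgt : X (src e) ≡ X (tgt e)
    X-src≡X-tgt =
      component-walk component (step e (Te , avoids-e₁ ¬w∈e) (inj₁ (refl , refl)) here)

    X-src≡X-u : X (src e) ≡ X u
    X-src≡X-u =
      component-walk component (reach-map (λ (Th , ¬w∈h) → Th , avoids-e₁ ¬w∈h) path)

    X-src≢X-w : X (src e) ≢ X w
    X-src≢X-w =
      crossing-ends-differ X u-w (component-crossed component Te₁) ∘ trans (sym X-src≡X-u)

module Cactus (C : MultiGraph) (cactus : IsCactus C) where
  open MultiGraph C
  open MultiGraphProperties C

  cycle-crosses-again : (c : Cycle C) (Y : VSet C) (i : Fin (suc (Cycle.len c))) →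
                        crosses C Y (Cycle.link c i) ≡ true →
                        ∃ λ j → j ≢ i × crosses C Y (Cycle.link c j) ≡ true
  cycle-crosses-again c Y i Yi
    with another-step-changes (suc len) (Y ∘ node) (cong Y closed) i
                              (crossing-ends-differ Y (joins i) Yi)
    where open Cycle c
  ... | j , j≢i , Yⱼ≢Yⱼ₊₁ = j , j≢i , differing-ends-cross Y (Cycle.joins c j) Yⱼ≢Yⱼ₊₁

  crossed-twice : ∀ (Y : VSet C) {a a′} → Y a ≡ true → Y a′ ≡ false →
                  ∃₂ λ h h′ → h ≢ h′ × crosses C Y h ≡ true × crosses C Y h′ ≡ true
  crossed-twice Y {a} {a′} Ya Ya′ with walk-crosses Y (proj₁ cactus a a′) Ya Ya′
  ... | h , _ , Yh with proj₁ (proj₂ cactus h)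
  ...   | c , i , refl with cycle-crosses-again c Y i Yh
  ...     | j , j≢i , Yj =
            Cycle.link c i , Cycle.link c j , j≢i ∘ sym ∘ Cycle.link-inj c i j , Yh , Yj

  module _ {b : Vertex C} {Q : VSet C}
           (crossings-at-b : ∀ h → crosses C Q h ≡ true → IncidentWith C b h)
           {Y : VSet C} (cut₂ : cutSize C Y ≡ 2) (Yb : Y b ≡ false) where

    member≢b : ∀ {n} → Y n ≡ true → n ≢ b
    member≢b Yn refl with trans (sym Yn) Yb
    ... | ()

    inner-agree : ∀ h → Y (src h) ≡ true → Y (tgt h) ≡ true → Q (src h) ≡ Q (tgt h)
    inner-agree h Ys Yt with Q (src h) ≟ᵇ Q (tgt h)
    ... | yes Qs≡Qt = Qs≡Qt
    ... | no  Qs≢Qt =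
          ⊥-elim ([ member≢b Ys , member≢b Yt ] (crossings-at-b h (≢⇒xor≡true _ _ Qs≢Qt)))

    Y∩Q Y∖Q : VSet C
    Y∩Q n = Y n ∧ Q n
    Y∖Q n = Y n ∧ not (Q n)

    Y∩Q-crossing : ∀ h → crosses C Y∩Q h ≡ true → crosses C Y h ≡ true
    Y∩Q-crossing h = ∧-xor⇒xor (Y (src h)) (Y (tgt h)) (Q (src h)) (Q (tgt h)) (inner-agree h)

    Y∖Q-crossing : ∀ h → crosses C Y∖Q h ≡ true → crosses C Y h ≡ true
    Y∖Q-crossing h = ∧-xor⇒xor (Y (src h)) (Y (tgt h)) (not (Q (src h))) (not (Q (tgt h)))
                               (λ Ys Yt → cong not (inner-agree h Ys Yt))

    crossings-disjoint : ∀ h → crosses C Y∩Q h ≡ true → crosses C Y∖Q h ≡ true → ⊥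
    crossings-disjoint h =
      ∧-xor-∧-not-xor (Y (src h)) (Y (tgt h)) (Q (src h)) (Q (tgt h)) (inner-agree h)

    shore-not-split : ∀ {a a′} → Y a ≡ true → Q a ≡ true → Y a′ ≡ true → Q a′ ≡ false → ⊥
    shore-not-split Ya Qa Ya′ Qa′
      with crossed-twice Y∩Q (cong₂ _∧_ Ya Qa) (cong (_∧ Q b) Yb)
         | crossed-twice Y∖Q (cong₂ _∧_ Ya′ (cong not Qa′)) (cong (_∧ not (Q b)) Yb)
    ... | h₁ , h₂ , h₁≢h₂ , h₁-crosses , h₂-crosses | h₃ , _ , _ , h₃-crosses , _ =
      n≮n 2 (subst (3 ≤_) cut₂ (3≤cutSize Y h₁≢h₂
        (λ { refl → crossings-disjoint h₁ h₁-crosses h₃-crosses })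
        (λ { refl → crossings-disjoint h₂ h₂-crosses h₃-crosses })
        (Y∩Q-crossing h₁ h₁-crosses) (Y∩Q-crossing h₂ h₂-crosses) (Y∖Q-crossing h₃ h₃-crosses)))

    shore-unsplit : ∀ {a a′} → Y a ≡ true → Y a′ ≡ true → Q a ≡ Q a′
    shore-unsplit {a} {a′} Ya Ya′ with Q a in Qa | Q a′ in Qa′
    ... | true  | true  = refl
    ... | false | false = refl
    ... | true  | false = ⊥-elim (shore-not-split Ya Qa Ya′ Qa′)
    ... | false | true  = ⊥-elim (shore-not-split Ya′ Qa′ Ya Qa)

  two-cut-side-unsplit : ∀ {b} Q → (∀ h → crosses C Q h ≡ true → IncidentWith C b h) →
                         ∀ (P : VSet C) → cutSize C P ≡ 2 →
                         ∀ {a a′} → P a ≢ P b → P a ≡ P a′ → Q a ≡ Q a′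
  two-cut-side-unsplit {b} Q crossings-at-b P cut₂ Pa≢Pb Pa≡Pa′ =
    shore-unsplit crossings-at-b {Y = λ n → P n xor P b}
      (trans (cutSize-xor P (P b)) cut₂) (xor-same (P b))
      (≢⇒xor≡true _ _ Pa≢Pb) (≢⇒xor≡true _ _ (Pa≢Pb ∘ trans Pa≡Pa′))

basicShore-crossings : ∀ {C b} Q → IsBasicShore C b Q →
                       ∀ h → crosses C Q h ≡ true → IncidentWith C b h
basicShore-crossings Q (_ , _ , _ , _ , _ , _ , b∈f , b∈g , crossing-links , _) h Qh
  with to (crossing-links h) Qh
... | inj₁ refl = b∈f
... | inj₂ refl = b∈g

mainTheorem4 : (G : MultiGraph) (K : ℕ) (T : ESet G) (C : MultiGraph)
    (φ : Vertex G → Vertex C) →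
    EdgeConnected G K → IsSpanningTree G T → CongestionAtMost G T K →
    IsCactusRep G K C φ →
    (b : Vertex C) (w : Vertex G) → φ w ≡ b →
    (Q : VSet C) → IsBasicShore C b Q →
    (e : Edge G) → T e ≡ true → crosses G (preimage G C φ Q) e ≡ true →
    IncidentWith G w e
mainTheorem4 G K T C φ connected tree congestion (cactus , represents)
             b w φw≡b Q shore e Te e-crosses =
  decidable-stable (incident? w e) λ ¬w∈e →
    xor≡true⇒≢ (Q (φ (src e))) (Q (φ (tgt e))) e-crosses (Q-agrees-on-ends ¬w∈e)
  where
  open MultiGraph G using (src; tgt)
  open MultiGraphProperties G using (incident?)
  open SpanningTree G T tree using (K-cut-separating)
  open Cactus C cactus using (two-cut-side-unsplit)

  Q-agrees-on-ends : ¬ IncidentWith G w e → Q (φ (src e)) ≡ Q (φ (tgt e))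
  Q-agrees-on-ends ¬w∈e with K-cut-separating connected congestion w e Te ¬w∈e
  ... | X , cutK , Xs≡Xt , Xs≢Xw with to (represents X) cutK
  ...   | P , cut₂ , X≡P∘φ = two-cut-side-unsplit Q (basicShore-crossings Q shore) P cut₂
            (subst₂ _≢_ (X≡P∘φ (src e)) (trans (X≡P∘φ w) (cong P φw≡b)) Xs≢Xw)
            (subst₂ _≡_ (X≡P∘φ (src e)) (X≡P∘φ (tgt e)) Xs≡Xt)
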